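{- Let $\mathbf A=\langle A,\land,\lor,*,\Rightarrow,1\rangle$ be a commutative integral residuated lattice and let $\mathbf A^*$ be its doubling. Then $\mathbf A^*$ (as the algebra $\langle A^*,\land,\lor,\Rightarrow,\neg,0,1\rangle$ with $0:=\neg1$) is an $\mathcal S$-algebra if and only if $\mathbf A$ is three-potent.
   Context: A commutative integral residuated lattice (CIRL) is an algebra $\langle A,\land,\lor,*,\Rightarrow,1\rangle$ such that $\langle A,\land,\lor\rangle$ is a lattice with top element $1$, $\langle A,*,1\rangle$ is a commutative monoid, and $a*b\le c$ iff $b\le a\Rightarrow c$. It is three-potent if $a*a\le a*a*a$ for all $a$. Doubling: given a CIRL $\mathbf A$, let $\neg A=\{\neg a:a\in A\}$ be a disjoint copy of $A$ and $A^*=A\cup\neg A$. Order $A^*$ by: for $a,b\in A$, $a\le b$ iff $a\le_A b$; $\neg a\le b$ always; $\neg a\le\neg b$ iff $b\le_A a$ (and $a\not\le\neg b$). Set $\neg(\neg a):=a$; on $A$ the operations are those of $\mathbf A$; $\neg a\land\neg b:=\neg(a\lor b)$, $\neg a\lor\neg b:=\neg(a\land b)$ (mixed meets/joins are determined by the order); $a*\neg b=\neg b*a:=\neg(a\Rightarrow b)$, $\neg a*\neg b:=\neg1$; $a\Rightarrow\neg b:=\neg(a*b)$, $\neg a\Rightarrow\neg b:=b\Rightarrow a$, $\neg a\Rightarrow b:=1$; the constants are $1$ and $0:=\neg 1$. Nelson's logic $\mathcal S$ is the sentential logic in the language $\langle\land,\lor,\Rightarrow,\neg,0\rangle$ given by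 the following Hilbert-style calculus. Abbreviations: $\phi\Leftrightarrow\psi:=(\phi\Rightarrow\psi)\land(\psi\Rightarrow\phi)$, $1:=\neg 0$, $\phi\Rightarrow^2\psi:=\phi\Rightarrow(\phi\Rightarrow\psi)$; for a finite (possibly empty) list $\Gamma=(\phi_1,\dots,\phi_n)$, $\Gamma\Rightarrow\phi:=\phi_1\Rightarrow(\phi_2\Rightarrow(\cdots(\phi_n\Rightarrow\phi)\cdots))$ and $\Gamma\Rightarrow^2\phi:=\phi_1\Rightarrow^2(\cdots(\phi_n\Rightarrow^2\phi)\cdots)$, both $\phi$ if $\Gamma$ is empty. Axioms: (A1) $\phi\Rightarrow\phi$; (A2) $0\Rightarrow\psi$; (A3) $\neg\phi\Rightarrow(\phi\Rightarrow0)$; (A4) $1$; (A5) $(\phi\Rightarrow\psi)\Leftrightarrow(\neg\psi\Rightarrow\neg\phi)$. Rules ("premisses / conclusion", for every finite list $\Gamma$): (P) $\Gamma\Rightarrow(\phi\Rightarrow(\psi\Rightarrow\gamma))$ / $\Gamma\Rightarrow(\psi\Rightarrow(\phi\Rightarrow\gamma))$; (C) $\phi\Rightarrow(\phi\Rightarrow(\phi\Rightarrow\gamma))$ / $\phi\Rightarrow(\phi\Rightarrow\gamma)$; (E) $\Gamma\Rightarrow\phi$, $\phi\Rightarrow\gamma$ / $\Gamma\Rightarrow\gamma$; ($\Rightarrow$l) $\Gamma\Rightarrow\phi$, $\psi\Rightarrow\gamma$ / $\Gamma\Rightarrow((\phi\Rightarrow\psi)\Rightarrow\gamma)$; ($\Rightarrow$r)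 $\gamma$ / $\phi\Rightarrow\gamma$; ($\land$l1) $\phi\Rightarrow\gamma$ / $(\phi\land\psi)\Rightarrow\gamma$; ($\land$l2) $\psi\Rightarrow\gamma$ / $(\phi\land\psi)\Rightarrow\gamma$; ($\land$r) $\Gamma\Rightarrow\phi$, $\Gamma\Rightarrow\psi$ / $\Gamma\Rightarrow(\phi\land\psi)$; ($\lor$l1) $\phi\Rightarrow\gamma$, $\psi\Rightarrow\gamma$ / $(\phi\lor\psi)\Rightarrow\gamma$; ($\lor$l2) $\phi\Rightarrow^2\gamma$, $\psi\Rightarrow^2\gamma$ / $(\phi\lor\psi)\Rightarrow^2\gamma$; ($\lor$r1) $\Gamma\Rightarrow\phi$ / $\Gamma\Rightarrow(\phi\lor\psi)$; ($\lor$r2) $\Gamma\Rightarrow\psi$ / $\Gamma\Rightarrow(\phi\lor\psi)$; ($\neg\Rightarrow$l) $(\phi\land\neg\psi)\Rightarrow\gamma$ / $\neg(\phi\Rightarrow\psi)\Rightarrow\gamma$; ($\neg\Rightarrow$r) $\Gamma\Rightarrow^2(\phi\land\neg\psi)$ / $\Gamma\Rightarrow^2\neg(\phi\Rightarrow\psi)$; ($\neg\land$l) $(\neg\phi\lor\neg\psi)\Rightarrow\gamma$ / $\neg(\phi\land\psi)\Rightarrow\gamma$; ($\neg\land$r) $\Gamma\Rightarrow(\neg\phi\lor\neg\psi)$ / $\Gamma\Rightarrow\neg(\phi\land\psi)$; ($\neg\lor$l) $(\neg\phi\land\neg\psi)\Rightarrow\gamma$ / $\neg(\phi\lor\psi)\Rightarrow\gamma$;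 ($\neg\lor$r) $\Gamma\Rightarrow(\neg\phi\land\neg\psi)$ / $\Gamma\Rightarrow\neg(\phi\lor\psi)$; ($\neg\neg$l) $\phi\Rightarrow\gamma$ / $\neg\neg\phi\Rightarrow\gamma$; ($\neg\neg$r) $\Gamma\Rightarrow\phi$ / $\Gamma\Rightarrow\neg\neg\phi$. An $\mathcal S$-algebra is an algebra $\langle A,\land,\lor,\Rightarrow,\neg,0,1\rangle$ of type $\langle2,2,2,1,0,0\rangle$ satisfying: (i) $\varphi\approx1$ for every axiom (A1)–(A5), formulas read as terms and the abbreviation $1:=\neg0$ written out (so (A4) gives $\neg0\approx1$); (ii) $x\Rightarrow x\approx1$; (iii) for each rule with premisses $\varphi_1,\dots,\varphi_n$ and conclusion $\varphi$, the quasi-equation $(\varphi_1\approx1\ \&\cdots\&\ \varphi_n\approx1)\Longrightarrow\varphi\approx1$; (iv) $(x\Rightarrow y\approx1\ \&\ y\Rightarrow x\approx1)\Longrightarrow x\approx y$. -}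

module Defs where

open import Level using (Level; suc)
open import Data.Sum using (_⊎_; inj₁; inj₂)
open import Data.List using (List; []; _∷_)
open import Data.Product using (_×_)
open import Function.Bundles using (_⇔_)
open import Relation.Binary.PropositionalEquality using (_≡_)
open import Algebra.Core using (Op₁; Op₂)
open import Algebra.Structures using (IsCommutativeMonoid)
open import Algebra.Lattice.Structures using (IsLattice)

record CIRL (a : Level) : Set (suc a) where
  infixr 6 _⇒_
  infixl 7 _*_
  infixr 7 _∧_
  infixr 6 _∨_
  field
    Carrier : Set a
    _∧_ _∨_ _*_ _⇒_ : Op₂ Carrier
    𝟙 : Carrier
    isLattice : IsLattice _≡_ _∨_ _∧_
    isCommutativeMonoid : IsCommutativeMonoid _≡_ _*_ 𝟙

  _≤_ : Carrier → Carrier → Set a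
  x ≤ y = x ∧ y ≡ x

  field
    top : ∀ x → x ≤ 𝟙
    residuation : ∀ x y z → ((x * y) ≤ z) ⇔ (y ≤ (x ⇒ z))

ThreePotent : ∀ {a} → CIRL a → Set a
ThreePotent A = ∀ x → (x * x) ≤ ((x * x) * x)
  where open CIRL A

record NAlg (a : Level) : Set (suc a) where
  infixr 4 _⇒_
  infixr 6 _∧_
  infixr 5 _∨_
  infix 8 ¬_
  field
    Carrier : Set a
    _∧_ _∨_ _⇒_ : Op₂ Carrier
    ¬_ : Op₁ Carrier
    𝟘 𝟙 : Carrier

module NAlgOps {a} (B : NAlg a) where
  open NAlg B
  infixr 4 _⇔'_ _⇒²_ _⇒*_ _⇒²*_

  _⇔'_ : Carrier → Carrier → Carrier
  x ⇔' y = (x ⇒ y) ∧ (y ⇒ x)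

  _⇒²_ : Carrier → Carrier → Carrier
  x ⇒² y = x ⇒ (x ⇒ y)

  _⇒*_ : List Carrier → Carrier → Carrier
  [] ⇒* φ = φ
  (ψ ∷ Γ) ⇒* φ = ψ ⇒ (Γ ⇒* φ)

  _⇒²*_ : List Carrier → Carrier → Carrier
  [] ⇒²* φ = φ
  (ψ ∷ Γ) ⇒²* φ = ψ ⇒² (Γ ⇒²* φ)

record IsSAlgebra {a} (B : NAlg a) : Set a where
  open NAlg B
  open NAlgOps B
  field
    A1 : ∀ x → (x ⇒ x) ≡ 𝟙
    A2 : ∀ y → (𝟘 ⇒ y) ≡ 𝟙
    A3 : ∀ x → (¬ x ⇒ (x ⇒ 𝟘)) ≡ 𝟙
    A4 : ¬ 𝟘 ≡ 𝟙
    A5 : ∀ x y → ((x ⇒ y) ⇔' (¬ y ⇒ ¬ x)) ≡ 𝟙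
    refl⇒ : ∀ x → (x ⇒ x) ≡ 𝟙
    P : ∀ Γ φ ψ γ → (Γ ⇒* (φ ⇒ (ψ ⇒ γ))) ≡ 𝟙 → (Γ ⇒* (ψ ⇒ (φ ⇒ γ))) ≡ 𝟙
    C : ∀ φ γ → (φ ⇒ (φ ⇒ (φ ⇒ γ))) ≡ 𝟙 → (φ ⇒ (φ ⇒ γ)) ≡ 𝟙
    E : ∀ Γ φ γ → (Γ ⇒* φ) ≡ 𝟙 → (φ ⇒ γ) ≡ 𝟙 → (Γ ⇒* γ) ≡ 𝟙
    ⇒l : ∀ Γ φ ψ γ → (Γ ⇒* φ) ≡ 𝟙 → (ψ ⇒ γ) ≡ 𝟙 → (Γ ⇒* ((φ ⇒ ψ) ⇒ γ)) ≡ 𝟙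
    ⇒r : ∀ φ γ → γ ≡ 𝟙 → (φ ⇒ γ) ≡ 𝟙
    ∧l1 : ∀ φ ψ γ → (φ ⇒ γ) ≡ 𝟙 → ((φ ∧ ψ) ⇒ γ) ≡ 𝟙
    ∧l2 : ∀ φ ψ γ → (ψ ⇒ γ) ≡ 𝟙 → ((φ ∧ ψ) ⇒ γ) ≡ 𝟙
    ∧r : ∀ Γ φ ψ → (Γ ⇒* φ) ≡ 𝟙 → (Γ ⇒* ψ) ≡ 𝟙 → (Γ ⇒* (φ ∧ ψ)) ≡ 𝟙
    ∨l1 : ∀ φ ψ γ → (φ ⇒ γ) ≡ 𝟙 → (ψ ⇒ γ) ≡ 𝟙 → ((φ ∨ ψ) ⇒ γ) ≡ 𝟙
    ∨l2 : ∀ φ ψ γ → (φ ⇒² γ) ≡ 𝟙 → (ψ ⇒² γ) ≡ 𝟙 → ((φ ∨ ψ) ⇒² γ) ≡ 𝟙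
    ∨r1 : ∀ Γ φ ψ → (Γ ⇒* φ) ≡ 𝟙 → (Γ ⇒* (φ ∨ ψ)) ≡ 𝟙
    ∨r2 : ∀ Γ φ ψ → (Γ ⇒* ψ) ≡ 𝟙 → (Γ ⇒* (φ ∨ ψ)) ≡ 𝟙
    ¬⇒l : ∀ φ ψ γ → ((φ ∧ ¬ ψ) ⇒ γ) ≡ 𝟙 → (¬ (φ ⇒ ψ) ⇒ γ) ≡ 𝟙
    ¬⇒r : ∀ Γ φ ψ → (Γ ⇒²* (φ ∧ ¬ ψ)) ≡ 𝟙 → (Γ ⇒²* ¬ (φ ⇒ ψ)) ≡ 𝟙
    ¬∧l : ∀ φ ψ γ → ((¬ φ ∨ ¬ ψ) ⇒ γ) ≡ 𝟙 → (¬ (φ ∧ ψ) ⇒ γ) ≡ 𝟙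
    ¬∧r : ∀ Γ φ ψ → (Γ ⇒* (¬ φ ∨ ¬ ψ)) ≡ 𝟙 → (Γ ⇒* ¬ (φ ∧ ψ)) ≡ 𝟙
    ¬∨l : ∀ φ ψ γ → ((¬ φ ∧ ¬ ψ) ⇒ γ) ≡ 𝟙 → (¬ (φ ∨ ψ) ⇒ γ) ≡ 𝟙
    ¬∨r : ∀ Γ φ ψ → (Γ ⇒* (¬ φ ∧ ¬ ψ)) ≡ 𝟙 → (Γ ⇒* ¬ (φ ∨ ψ)) ≡ 𝟙
    ¬¬l : ∀ φ γ → (φ ⇒ γ) ≡ 𝟙 → (¬ ¬ φ ⇒ γ) ≡ 𝟙
    ¬¬r : ∀ Γ φ → (Γ ⇒* φ) ≡ 𝟙 → (Γ ⇒* ¬ ¬ φ) ≡ 𝟙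
    antisym : ∀ x y → (x ⇒ y) ≡ 𝟙 → (y ⇒ x) ≡ 𝟙 → x ≡ y

-- The doubling A* : carrier A ⊎ A, with inj₁ a = a and inj₂ a = ¬a

module _ {a} (A : CIRL a) where
  open CIRL A

  D : Set a
  D = Carrier ⊎ Carrier

  neg : D → D
  neg (inj₁ x) = inj₂ x
  neg (inj₂ x) = inj₁ x

  meet : D → D → D
  meet (inj₁ x) (inj₁ y) = inj₁ (x ∧ y)
  meet (inj₁ x) (inj₂ y) = inj₂ y          -- ¬y ≤ x
  meet (inj₂ x) (inj₁ y) = inj₂ x          -- ¬x ≤ y
  meet (inj₂ x) (inj₂ y) = inj₂ (x ∨ y)    -- ¬x ∧ ¬y = ¬(x ∨ y)

  join : D → D → D
  join (inj₁ x) (inj₁ y) = inj₁ (x ∨ y)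
  join (inj₁ x) (inj₂ y) = inj₁ x
  join (inj₂ x) (inj₁ y) = inj₁ y
  join (inj₂ x) (inj₂ y) = inj₂ (x ∧ y)    -- ¬x ∨ ¬y = ¬(x ∧ y)

  imp : D → D → D
  imp (inj₁ x) (inj₁ y) = inj₁ (x ⇒ y)
  imp (inj₁ x) (inj₂ y) = inj₂ (x * y)
  imp (inj₂ x) (inj₁ y) = inj₁ 𝟙
  imp (inj₂ x) (inj₂ y) = inj₁ (y ⇒ x)

  Double : NAlg a
  Double = record
    { Carrier = D
    ; _∧_ = meet
    ; _∨_ = join
    ; _⇒_ = imp
    ; ¬_ = neg
    ; 𝟘 = inj₂ 𝟙
    ; 𝟙 = inj₁ 𝟙
    }

module Submission where

-- A* carries, besides ∧, ∨, ⇒ and ¬, a commutative product ⊛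
-- (a ⊛ ¬b = ¬(a ⇒ b), ¬a ⊛ ¬b = ¬1) for which it is again a commutative
-- integral residuated lattice, and x ⇒ y = 1 holds exactly when x ≤ y.
-- Hence a sequent Γ ⇒ φ evaluates to 1 exactly when ∏Γ ≤ φ, and every rule
-- of 𝒮 becomes an order-theoretic statement about (A*, ≤, ⊛).
--   * CIRLFacts: elementary facts about A (order, residuation, currying).
--   * Doubling: the order and product of A*, its residuation law and the
--     usual consequences (integrality, monotonicity, modus ponens, ⊛
--     distributing over ∨), the De Morgan laws, and the reading of sequents.
--   * Three-potency lifts from A to A*; under it squares are idempotent,
--     so the context of a sequent Γ ⇒² φ denotes an idempotent, and if the
--     squares of x and y lie below γ then so does the square of x ∨ y.
--     These facts validate (C), (∨l2) and (¬⇒r); every other axiom and rule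
--     holds in any doubling.
--   * Conversely, (C) applied to a ∈ A with γ = a³ yields a² ≤ a³.

open import Defs
open import Level using (Level)
open import Function.Bundles using (_⇔_; mk⇔; Equivalence)
open import Data.Sum using (inj₁; inj₂)
open import Data.Sum.Properties using (inj₁-injective)
open import Data.List using (List; []; _∷_)
open import Relation.Binary.PropositionalEquality
  using (_≡_; refl; sym; trans; cong; cong₂; subst; subst₂; isEquivalence; module ≡-Reasoning)
open import Relation.Binary.Bundles using (Preorder)
open import Algebra.Structures using (IsCommutativeMonoid)
open import Algebra.Lattice.Bundles using (Lattice)
import Algebra.Lattice.Properties.Lattice as LatticeProperties
import Relation.Binary.Lattice as OrderTheoretic
import Relation.Binary.Reasoning.Preorder as PreorderReasoning

module CIRLFacts {a : Level} (A : CIRL a) where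
  open CIRL A
  open IsCommutativeMonoid isCommutativeMonoid
    using () renaming (comm to *-comm; assoc to *-assoc; identityˡ to *-identityˡ; identityʳ to *-identityʳ)

  -- The order x ≤ y := x ∧ y ≡ x is the library's natural order of the
  -- lattice, with the defining equation read the other way round.
  private
    lattice : Lattice a a
    lattice = record { isLattice = isLattice }

    module Ord = OrderTheoretic.IsLattice (LatticeProperties.∨-∧-isOrderTheoreticLattice lattice)

  ≤-refl : ∀ {x} → x ≤ x
  ≤-refl = sym Ord.refl

  ≤-reflexive : ∀ {x y} → x ≡ y → x ≤ y
  ≤-reflexive refl = ≤-refl

  ≤-trans : ∀ {x y z} → x ≤ y → y ≤ z → x ≤ z
  ≤-trans p q = sym (Ord.trans (sym p) (sym q))

  ≤-antisym : ∀ {x y} → x ≤ y → y ≤ x → x ≡ y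
  ≤-antisym p q = Ord.antisym (sym p) (sym q)

  x∧y≤x : ∀ x y → (x ∧ y) ≤ x
  x∧y≤x x y = sym (Ord.x∧y≤x x y)

  x∧y≤y : ∀ x y → (x ∧ y) ≤ y
  x∧y≤y x y = sym (Ord.x∧y≤y x y)

  ∧-greatest : ∀ {x y z} → z ≤ x → z ≤ y → z ≤ (x ∧ y)
  ∧-greatest p q = sym (Ord.∧-greatest (sym p) (sym q))

  x≤x∨y : ∀ x y → x ≤ (x ∨ y)
  x≤x∨y x y = sym (Ord.x≤x∨y x y)

  y≤x∨y : ∀ x y → y ≤ (x ∨ y)
  y≤x∨y x y = sym (Ord.y≤x∨y x y)

  ∨-least : ∀ {x y z} → x ≤ z → y ≤ z → (x ∨ y) ≤ z
  ∨-least p q = sym (Ord.∨-least (sym p) (sym q))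

  residuate : ∀ {u v w} → (u * w) ≤ v → w ≤ (u ⇒ v)
  residuate {u} {v} {w} = Equivalence.to (residuation u w v)

  unresiduate : ∀ {u v w} → w ≤ (u ⇒ v) → (u * w) ≤ v
  unresiduate {u} {v} {w} = Equivalence.from (residuation u w v)

  ⇒≡𝟙→≤ : ∀ {x y} → (x ⇒ y) ≡ 𝟙 → x ≤ y
  ⇒≡𝟙→≤ {x} p = ≤-trans (≤-reflexive (sym (*-identityʳ x))) (unresiduate (≤-reflexive (sym p)))

  ≤→⇒≡𝟙 : ∀ {x y} → x ≤ y → (x ⇒ y) ≡ 𝟙
  ≤→⇒≡𝟙 {x} {y} p = ≤-antisym (top (x ⇒ y)) (residuate (≤-trans (≤-reflexive (*-identityʳ x)) p))

  same-lower-bounds : ∀ {u v} → (∀ {w} → w ≤ u → w ≤ v) → (∀ {w} → w ≤ v → w ≤ u) → u ≡ v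
  same-lower-bounds f g = ≤-antisym (f ≤-refl) (g ≤-refl)

  -- Currying and the unit laws of ⇒; they give the product of A* its
  -- associativity and residuation.
  curry : ∀ x y z → x ⇒ (y ⇒ z) ≡ (x * y) ⇒ z
  curry x y z = same-lower-bounds
    (λ p → residuate (≤-trans (≤-reflexive (reorder _)) (unresiduate (unresiduate p))))
    (λ p → residuate (residuate (≤-trans (≤-reflexive (sym (reorder _))) (unresiduate p))))
    where
    reorder : ∀ w → (x * y) * w ≡ y * (x * w)
    reorder w = trans (cong (_* w) (*-comm x y)) (*-assoc y x w)

  exchange : ∀ x y z → x ⇒ (y ⇒ z) ≡ y ⇒ (x ⇒ z)
  exchange x y z = trans (curry x y z) (trans (cong (_⇒ z) (*-comm x y)) (sym (curry y x z)))

  𝟙⇒ : ∀ y → 𝟙 ⇒ y ≡ y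
  𝟙⇒ y = same-lower-bounds
    (λ p → ≤-trans (≤-reflexive (sym (*-identityˡ _))) (unresiduate p))
    (λ p → residuate (≤-trans (≤-reflexive (*-identityˡ _)) p))

  ⇒𝟙 : ∀ y → y ⇒ 𝟙 ≡ 𝟙
  ⇒𝟙 y = ≤→⇒≡𝟙 (top y)

module Doubling {a : Level} (A : CIRL a) where
  open CIRL A
  open CIRLFacts A
  open IsCommutativeMonoid isCommutativeMonoid
    using () renaming (comm to *-comm; assoc to *-assoc; identityˡ to *-identityˡ)

  infixr 5 _⇒ᴰ_
  infixr 7 _∧ᴰ_
  infixr 6 _∨ᴰ_
  infixl 8 _⊛_
  infix 9 ∼_
  infix 4 _≤ᴰ_

  _⇒ᴰ_ _∧ᴰ_ _∨ᴰ_ : D A → D A → D A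
  _⇒ᴰ_ = imp A
  _∧ᴰ_ = meet A
  _∨ᴰ_ = join A

  ∼_ : D A → D A
  ∼_ = neg A

  𝟙ᴰ 𝟘ᴰ : D A
  𝟙ᴰ = inj₁ 𝟙
  𝟘ᴰ = inj₂ 𝟙

  data _≤ᴰ_ : D A → D A → Set a where
    pos≤pos : ∀ {x y} → x ≤ y → inj₁ x ≤ᴰ inj₁ y
    neg≤pos : ∀ {x y} → inj₂ x ≤ᴰ inj₁ y
    neg≤neg : ∀ {x y} → y ≤ x → inj₂ x ≤ᴰ inj₂ y

  ≤ᴰ-refl : ∀ {x} → x ≤ᴰ x
  ≤ᴰ-refl {inj₁ x} = pos≤pos ≤-refl
  ≤ᴰ-refl {inj₂ x} = neg≤neg ≤-refl

  ≤ᴰ-reflexive : ∀ {x y} → x ≡ y → x ≤ᴰ y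
  ≤ᴰ-reflexive refl = ≤ᴰ-refl

  ≤ᴰ-trans : ∀ {x y z} → x ≤ᴰ y → y ≤ᴰ z → x ≤ᴰ z
  ≤ᴰ-trans (pos≤pos p) (pos≤pos q) = pos≤pos (≤-trans p q)
  ≤ᴰ-trans neg≤pos (pos≤pos q) = neg≤pos
  ≤ᴰ-trans (neg≤neg p) neg≤pos = neg≤pos
  ≤ᴰ-trans (neg≤neg p) (neg≤neg q) = neg≤neg (≤-trans q p)

  ≤ᴰ-antisym : ∀ {x y} → x ≤ᴰ y → y ≤ᴰ x → x ≡ y
  ≤ᴰ-antisym (pos≤pos p) (pos≤pos q) = cong inj₁ (≤-antisym p q)
  ≤ᴰ-antisym (neg≤neg p) (neg≤neg q) = cong inj₂ (≤-antisym q p)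

  ≤ᴰ-preorder : Preorder a a a
  ≤ᴰ-preorder = record
    { _≈_ = _≡_
    ; _≲_ = _≤ᴰ_
    ; isPreorder = record { isEquivalence = isEquivalence ; reflexive = ≤ᴰ-reflexive ; trans = ≤ᴰ-trans }
    }

  ≤ᴰ-top : ∀ x → x ≤ᴰ 𝟙ᴰ
  ≤ᴰ-top (inj₁ x) = pos≤pos (top x)
  ≤ᴰ-top (inj₂ x) = neg≤pos

  ≤ᴰ-bottom : ∀ x → 𝟘ᴰ ≤ᴰ x
  ≤ᴰ-bottom (inj₁ x) = neg≤pos
  ≤ᴰ-bottom (inj₂ x) = neg≤neg (top x)

  x∧ᴰy≤x : ∀ x y → x ∧ᴰ y ≤ᴰ x
  x∧ᴰy≤x (inj₁ x) (inj₁ y) = pos≤pos (x∧y≤x x y)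
  x∧ᴰy≤x (inj₁ x) (inj₂ y) = neg≤pos
  x∧ᴰy≤x (inj₂ x) (inj₁ y) = ≤ᴰ-refl
  x∧ᴰy≤x (inj₂ x) (inj₂ y) = neg≤neg (x≤x∨y x y)

  x∧ᴰy≤y : ∀ x y → x ∧ᴰ y ≤ᴰ y
  x∧ᴰy≤y (inj₁ x) (inj₁ y) = pos≤pos (x∧y≤y x y)
  x∧ᴰy≤y (inj₁ x) (inj₂ y) = ≤ᴰ-refl
  x∧ᴰy≤y (inj₂ x) (inj₁ y) = neg≤pos
  x∧ᴰy≤y (inj₂ x) (inj₂ y) = neg≤neg (y≤x∨y x y)

  ∧ᴰ-greatest : ∀ {x y z} → z ≤ᴰ x → z ≤ᴰ y → z ≤ᴰ x ∧ᴰ y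
  ∧ᴰ-greatest (pos≤pos p) (pos≤pos q) = pos≤pos (∧-greatest p q)
  ∧ᴰ-greatest neg≤pos neg≤pos = neg≤pos
  ∧ᴰ-greatest neg≤pos (neg≤neg q) = neg≤neg q
  ∧ᴰ-greatest (neg≤neg p) neg≤pos = neg≤neg p
  ∧ᴰ-greatest (neg≤neg p) (neg≤neg q) = neg≤neg (∨-least p q)

  x≤x∨ᴰy : ∀ x y → x ≤ᴰ x ∨ᴰ y
  x≤x∨ᴰy (inj₁ x) (inj₁ y) = pos≤pos (x≤x∨y x y)
  x≤x∨ᴰy (inj₁ x) (inj₂ y) = ≤ᴰ-refl
  x≤x∨ᴰy (inj₂ x) (inj₁ y) = neg≤pos
  x≤x∨ᴰy (inj₂ x) (inj₂ y) = neg≤neg (x∧y≤x x y)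

  y≤x∨ᴰy : ∀ x y → y ≤ᴰ x ∨ᴰ y
  y≤x∨ᴰy (inj₁ x) (inj₁ y) = pos≤pos (y≤x∨y x y)
  y≤x∨ᴰy (inj₁ x) (inj₂ y) = neg≤pos
  y≤x∨ᴰy (inj₂ x) (inj₁ y) = ≤ᴰ-refl
  y≤x∨ᴰy (inj₂ x) (inj₂ y) = neg≤neg (x∧y≤y x y)

  ∨ᴰ-least : ∀ {x y z} → x ≤ᴰ z → y ≤ᴰ z → x ∨ᴰ y ≤ᴰ z
  ∨ᴰ-least (pos≤pos p) (pos≤pos q) = pos≤pos (∨-least p q)
  ∨ᴰ-least (pos≤pos p) neg≤pos = pos≤pos p
  ∨ᴰ-least neg≤pos (pos≤pos q) = pos≤pos q
  ∨ᴰ-least neg≤pos neg≤pos = neg≤pos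
  ∨ᴰ-least (neg≤neg p) (neg≤neg q) = neg≤neg (∧-greatest p q)

  ⇒ᴰ≡𝟙→≤ᴰ : ∀ x y → x ⇒ᴰ y ≡ 𝟙ᴰ → x ≤ᴰ y
  ⇒ᴰ≡𝟙→≤ᴰ (inj₁ x) (inj₁ y) p = pos≤pos (⇒≡𝟙→≤ (inj₁-injective p))
  ⇒ᴰ≡𝟙→≤ᴰ (inj₂ x) (inj₁ y) p = neg≤pos
  ⇒ᴰ≡𝟙→≤ᴰ (inj₂ x) (inj₂ y) p = neg≤neg (⇒≡𝟙→≤ (inj₁-injective p))

  ≤ᴰ→⇒ᴰ≡𝟙 : ∀ {x y} → x ≤ᴰ y → x ⇒ᴰ y ≡ 𝟙ᴰ
  ≤ᴰ→⇒ᴰ≡𝟙 (pos≤pos p) = cong inj₁ (≤→⇒≡𝟙 p)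
  ≤ᴰ→⇒ᴰ≡𝟙 neg≤pos = refl
  ≤ᴰ→⇒ᴰ≡𝟙 (neg≤neg p) = cong inj₁ (≤→⇒≡𝟙 p)

  ⇒ᴰ-refl : ∀ x → x ⇒ᴰ x ≡ 𝟙ᴰ
  ⇒ᴰ-refl x = ≤ᴰ→⇒ᴰ≡𝟙 ≤ᴰ-refl

  _⊛_ : D A → D A → D A
  inj₁ x ⊛ inj₁ y = inj₁ (x * y)
  inj₁ x ⊛ inj₂ y = inj₂ (x ⇒ y)
  inj₂ x ⊛ inj₁ y = inj₂ (y ⇒ x)
  inj₂ x ⊛ inj₂ y = 𝟘ᴰ

  ⊛-comm : ∀ x y → x ⊛ y ≡ y ⊛ x
  ⊛-comm (inj₁ x) (inj₁ y) = cong inj₁ (*-comm x y)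
  ⊛-comm (inj₁ x) (inj₂ y) = refl
  ⊛-comm (inj₂ x) (inj₁ y) = refl
  ⊛-comm (inj₂ x) (inj₂ y) = refl

  ⊛-assoc : ∀ x y z → (x ⊛ y) ⊛ z ≡ x ⊛ (y ⊛ z)
  ⊛-assoc (inj₁ x) (inj₁ y) (inj₁ z) = cong inj₁ (*-assoc x y z)
  ⊛-assoc (inj₁ x) (inj₁ y) (inj₂ z) = cong inj₂ (sym (curry x y z))
  ⊛-assoc (inj₁ x) (inj₂ y) (inj₁ z) = cong inj₂ (exchange z x y)
  ⊛-assoc (inj₁ x) (inj₂ y) (inj₂ z) = cong inj₂ (sym (⇒𝟙 x))
  ⊛-assoc (inj₂ x) (inj₁ y) (inj₁ z) = cong inj₂ (trans (curry z y x) (cong (_⇒ x) (*-comm z y)))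
  ⊛-assoc (inj₂ x) (inj₁ y) (inj₂ z) = refl
  ⊛-assoc (inj₂ x) (inj₂ y) (inj₁ z) = cong inj₂ (⇒𝟙 z)
  ⊛-assoc (inj₂ x) (inj₂ y) (inj₂ z) = refl

  curryᴰ : ∀ x y z → x ⇒ᴰ (y ⇒ᴰ z) ≡ x ⊛ y ⇒ᴰ z
  curryᴰ (inj₁ x) (inj₁ y) (inj₁ z) = cong inj₁ (curry x y z)
  curryᴰ (inj₁ x) (inj₁ y) (inj₂ z) = cong inj₂ (sym (*-assoc x y z))
  curryᴰ (inj₁ x) (inj₂ y) (inj₁ z) = cong inj₁ (⇒𝟙 x)
  curryᴰ (inj₁ x) (inj₂ y) (inj₂ z) = cong inj₁ (exchange x z y)
  curryᴰ (inj₂ x) (inj₁ y) (inj₁ z) = refl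
  curryᴰ (inj₂ x) (inj₁ y) (inj₂ z) = cong inj₁ (trans (cong (_⇒ x) (*-comm y z)) (sym (curry z y x)))
  curryᴰ (inj₂ x) (inj₂ y) (inj₁ z) = refl
  curryᴰ (inj₂ x) (inj₂ y) (inj₂ z) = cong inj₁ (sym (⇒𝟙 z))

  𝟙ᴰ⇒ᴰ : ∀ x → 𝟙ᴰ ⇒ᴰ x ≡ x
  𝟙ᴰ⇒ᴰ (inj₁ x) = cong inj₁ (𝟙⇒ x)
  𝟙ᴰ⇒ᴰ (inj₂ x) = cong inj₂ (*-identityˡ x)

  residuateᴰ : ∀ x y z → x ⊛ y ≤ᴰ z → y ≤ᴰ x ⇒ᴰ z
  residuateᴰ x y z p = ⇒ᴰ≡𝟙→≤ᴰ y (x ⇒ᴰ z) (begin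
    y ⇒ᴰ x ⇒ᴰ z  ≡⟨ curryᴰ y x z ⟩
    y ⊛ x ⇒ᴰ z   ≡⟨ cong (_⇒ᴰ z) (⊛-comm y x) ⟩
    x ⊛ y ⇒ᴰ z   ≡⟨ ≤ᴰ→⇒ᴰ≡𝟙 p ⟩
    𝟙ᴰ           ∎)
    where open ≡-Reasoning

  unresiduateᴰ : ∀ x y z → y ≤ᴰ x ⇒ᴰ z → x ⊛ y ≤ᴰ z
  unresiduateᴰ x y z p = ⇒ᴰ≡𝟙→≤ᴰ (x ⊛ y) z (begin
    x ⊛ y ⇒ᴰ z   ≡⟨ cong (_⇒ᴰ z) (⊛-comm x y) ⟩
    y ⊛ x ⇒ᴰ z   ≡⟨ curryᴰ y x z ⟨
    y ⇒ᴰ x ⇒ᴰ z  ≡⟨ ≤ᴰ→⇒ᴰ≡𝟙 p ⟩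
    𝟙ᴰ           ∎)
    where open ≡-Reasoning

  ⊛-decreasingʳ : ∀ x y → x ⊛ y ≤ᴰ y
  ⊛-decreasingʳ x y = ≤ᴰ-trans (≤ᴰ-reflexive (⊛-comm x y))
    (unresiduateᴰ y x y (≤ᴰ-trans (≤ᴰ-top x) (≤ᴰ-reflexive (sym (⇒ᴰ-refl y)))))

  ⊛-decreasingˡ : ∀ x y → x ⊛ y ≤ᴰ x
  ⊛-decreasingˡ x y = ≤ᴰ-trans (≤ᴰ-reflexive (⊛-comm x y)) (⊛-decreasingʳ y x)

  ⊛-monoʳ : ∀ x {y z} → y ≤ᴰ z → x ⊛ y ≤ᴰ x ⊛ z
  ⊛-monoʳ x {y} {z} p = unresiduateᴰ x y (x ⊛ z) (≤ᴰ-trans p (residuateᴰ x z (x ⊛ z) ≤ᴰ-refl))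

  ⊛-monoˡ : ∀ {x y} z → x ≤ᴰ y → x ⊛ z ≤ᴰ y ⊛ z
  ⊛-monoˡ {x} {y} z p = subst₂ _≤ᴰ_ (⊛-comm z x) (⊛-comm z y) (⊛-monoʳ z p)

  modus-ponensᴰ : ∀ x y → x ⊛ (x ⇒ᴰ y) ≤ᴰ y
  modus-ponensᴰ x y = unresiduateᴰ x (x ⇒ᴰ y) y ≤ᴰ-refl

  -- ⊛ distributes over ∨ᴰ, in the form needed for upper bounds.
  ⊛-∨ᴰ-boundʳ : ∀ w x y {γ} → w ⊛ x ≤ᴰ γ → w ⊛ y ≤ᴰ γ → w ⊛ (x ∨ᴰ y) ≤ᴰ γ
  ⊛-∨ᴰ-boundʳ w x y {γ} p q =
    unresiduateᴰ w (x ∨ᴰ y) γ (∨ᴰ-least (residuateᴰ w x γ p) (residuateᴰ w y γ q))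

  ⊛-∨ᴰ-boundˡ : ∀ x y w {γ} → x ⊛ w ≤ᴰ γ → y ⊛ w ≤ᴰ γ → (x ∨ᴰ y) ⊛ w ≤ᴰ γ
  ⊛-∨ᴰ-boundˡ x y w p q = ≤ᴰ-trans (≤ᴰ-reflexive (⊛-comm (x ∨ᴰ y) w))
    (⊛-∨ᴰ-boundʳ w x y (≤ᴰ-trans (≤ᴰ-reflexive (⊛-comm w x)) p) (≤ᴰ-trans (≤ᴰ-reflexive (⊛-comm w y)) q))

  ⊛-swapʳ : ∀ x y z → x ⊛ y ⊛ z ≡ x ⊛ z ⊛ y
  ⊛-swapʳ x y z = trans (⊛-assoc x y z) (trans (cong (x ⊛_) (⊛-comm y z)) (sym (⊛-assoc x z y)))

  ⊛-interchange : ∀ p q r s → (p ⊛ q) ⊛ (r ⊛ s) ≡ (p ⊛ r) ⊛ (q ⊛ s)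
  ⊛-interchange p q r s = begin
    (p ⊛ q) ⊛ (r ⊛ s)  ≡⟨ ⊛-assoc (p ⊛ q) r s ⟨
    p ⊛ q ⊛ r ⊛ s      ≡⟨ cong (_⊛ s) (⊛-swapʳ p q r) ⟩
    p ⊛ r ⊛ q ⊛ s      ≡⟨ ⊛-assoc (p ⊛ r) q s ⟩
    (p ⊛ r) ⊛ (q ⊛ s)  ∎
    where open ≡-Reasoning

  exchangeᴰ : ∀ x y z → x ⇒ᴰ y ⇒ᴰ z ≡ y ⇒ᴰ x ⇒ᴰ z
  exchangeᴰ x y z = trans (curryᴰ x y z) (trans (cong (_⇒ᴰ z) (⊛-comm x y)) (sym (curryᴰ y x z)))

  ⊛≤∧ᴰ : ∀ x y → x ⊛ y ≤ᴰ x ∧ᴰ y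
  ⊛≤∧ᴰ x y = ∧ᴰ-greatest (⊛-decreasingˡ x y) (⊛-decreasingʳ x y)

  ∼x⊛x≤𝟘ᴰ : ∀ x → ∼ x ⊛ x ≤ᴰ 𝟘ᴰ
  ∼x⊛x≤𝟘ᴰ (inj₁ x) = neg≤neg (≤-reflexive (sym (≤→⇒≡𝟙 ≤-refl)))
  ∼x⊛x≤𝟘ᴰ (inj₂ x) = neg≤neg (≤-reflexive (sym (≤→⇒≡𝟙 ≤-refl)))

  ∼-⇒ᴰ : ∀ x y → ∼ (x ⇒ᴰ y) ≡ x ⊛ ∼ y
  ∼-⇒ᴰ (inj₁ x) (inj₁ y) = refl
  ∼-⇒ᴰ (inj₁ x) (inj₂ y) = refl
  ∼-⇒ᴰ (inj₂ x) (inj₁ y) = refl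
  ∼-⇒ᴰ (inj₂ x) (inj₂ y) = refl

  ∼-∧ᴰ : ∀ x y → ∼ (x ∧ᴰ y) ≡ ∼ x ∨ᴰ ∼ y
  ∼-∧ᴰ (inj₁ x) (inj₁ y) = refl
  ∼-∧ᴰ (inj₁ x) (inj₂ y) = refl
  ∼-∧ᴰ (inj₂ x) (inj₁ y) = refl
  ∼-∧ᴰ (inj₂ x) (inj₂ y) = refl

  ∼-∨ᴰ : ∀ x y → ∼ (x ∨ᴰ y) ≡ ∼ x ∧ᴰ ∼ y
  ∼-∨ᴰ (inj₁ x) (inj₁ y) = refl
  ∼-∨ᴰ (inj₁ x) (inj₂ y) = refl
  ∼-∨ᴰ (inj₂ x) (inj₁ y) = refl
  ∼-∨ᴰ (inj₂ x) (inj₂ y) = refl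

  ∼-involutive : ∀ x → ∼ ∼ x ≡ x
  ∼-involutive (inj₁ x) = refl
  ∼-involutive (inj₂ x) = refl

  contraposition : ∀ x y → ∼ y ⇒ᴰ ∼ x ≡ x ⇒ᴰ y
  contraposition (inj₁ x) (inj₁ y) = refl
  contraposition (inj₁ x) (inj₂ y) = cong inj₂ (*-comm y x)
  contraposition (inj₂ x) (inj₁ y) = refl
  contraposition (inj₂ x) (inj₂ y) = refl

  ⇔ᴰ-refl : ∀ {x y} → x ≡ y → (x ⇒ᴰ y) ∧ᴰ (y ⇒ᴰ x) ≡ 𝟙ᴰ
  ⇔ᴰ-refl {x} refl = trans (cong₂ _∧ᴰ_ (⇒ᴰ-refl x) (⇒ᴰ-refl x)) (cong inj₁ ≤-refl)

  open NAlgOps (Double A) using (_⇒*_; _⇒²*_)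

  ∏ : List (D A) → D A
  ∏ [] = 𝟙ᴰ
  ∏ (x ∷ Γ) = x ⊛ ∏ Γ

  doubled : List (D A) → List (D A)
  doubled [] = []
  doubled (x ∷ Γ) = x ∷ x ∷ doubled Γ

  ⇒*-as-∏ : ∀ Γ φ → (Γ ⇒* φ) ≡ ∏ Γ ⇒ᴰ φ
  ⇒*-as-∏ [] φ = sym (𝟙ᴰ⇒ᴰ φ)
  ⇒*-as-∏ (ψ ∷ Γ) φ = trans (cong (ψ ⇒ᴰ_) (⇒*-as-∏ Γ φ)) (curryᴰ ψ (∏ Γ) φ)

  ⇒²*-as-doubled : ∀ Γ φ → (Γ ⇒²* φ) ≡ (doubled Γ ⇒* φ)
  ⇒²*-as-doubled [] φ = refl
  ⇒²*-as-doubled (ψ ∷ Γ) φ = cong (λ u → ψ ⇒ᴰ ψ ⇒ᴰ u) (⇒²*-as-doubled Γ φ)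

  valid→ : ∀ Γ φ → (Γ ⇒* φ) ≡ 𝟙ᴰ → ∏ Γ ≤ᴰ φ
  valid→ Γ φ p = ⇒ᴰ≡𝟙→≤ᴰ (∏ Γ) φ (trans (sym (⇒*-as-∏ Γ φ)) p)

  valid← : ∀ Γ φ → ∏ Γ ≤ᴰ φ → (Γ ⇒* φ) ≡ 𝟙ᴰ
  valid← Γ φ p = trans (⇒*-as-∏ Γ φ) (≤ᴰ→⇒ᴰ≡𝟙 p)

  valid²→ : ∀ Γ φ → (Γ ⇒²* φ) ≡ 𝟙ᴰ → ∏ (doubled Γ) ≤ᴰ φ
  valid²→ Γ φ p = valid→ (doubled Γ) φ (trans (sym (⇒²*-as-doubled Γ φ)) p)

  valid²← : ∀ Γ φ → ∏ (doubled Γ) ≤ᴰ φ → (Γ ⇒²* φ) ≡ 𝟙ᴰ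
  valid²← Γ φ p = trans (⇒²*-as-doubled Γ φ) (valid← (doubled Γ) φ p)

  square-valid→ : ∀ x γ → x ⇒ᴰ x ⇒ᴰ γ ≡ 𝟙ᴰ → x ⊛ x ≤ᴰ γ
  square-valid→ x γ p = ⇒ᴰ≡𝟙→≤ᴰ (x ⊛ x) γ (trans (sym (curryᴰ x x γ)) p)

  square-valid← : ∀ x γ → x ⊛ x ≤ᴰ γ → x ⇒ᴰ x ⇒ᴰ γ ≡ 𝟙ᴰ
  square-valid← x γ p = trans (curryᴰ x x γ) (≤ᴰ→⇒ᴰ≡𝟙 p)

  -- Three-potency.  By integrality x ⊛ x ≤ x always holds, so x is
  -- ⊛-idempotent as soon as x ≤ x ⊛ x.
  Idempotentᴰ : D A → Set a
  Idempotentᴰ x = x ≤ᴰ x ⊛ x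

  -- A three-potent A has a three-potent doubling (on ¬A both sides are 0).
  three-potentᴰ : ThreePotent A → ∀ x → x ⊛ x ≤ᴰ x ⊛ (x ⊛ x)
  three-potentᴰ T (inj₁ x) = pos≤pos (≤-trans (T x) (≤-reflexive (*-comm (x * x) x)))
  three-potentᴰ T (inj₂ x) = ≤ᴰ-refl

  square-idempotent : ThreePotent A → ∀ x → Idempotentᴰ (x ⊛ x)
  square-idempotent T x = begin
    x ⊛ x              ≲⟨ three-potentᴰ T x ⟩
    x ⊛ (x ⊛ x)        ≲⟨ ⊛-monoʳ x (three-potentᴰ T x) ⟩
    x ⊛ (x ⊛ (x ⊛ x))  ≡⟨ ⊛-assoc x x (x ⊛ x) ⟨
    (x ⊛ x) ⊛ (x ⊛ x)  ∎
    where open PreorderReasoning ≤ᴰ-preorder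

  ⊛-idempotent : ∀ {x y} → Idempotentᴰ x → Idempotentᴰ y → Idempotentᴰ (x ⊛ y)
  ⊛-idempotent {x} {y} idem-x idem-y = begin
    x ⊛ y              ≲⟨ ⊛-monoˡ y idem-x ⟩
    (x ⊛ x) ⊛ y        ≲⟨ ⊛-monoʳ (x ⊛ x) idem-y ⟩
    (x ⊛ x) ⊛ (y ⊛ y)  ≡⟨ ⊛-interchange x x y y ⟩
    (x ⊛ y) ⊛ (x ⊛ y)  ∎
    where open PreorderReasoning ≤ᴰ-preorder

  ∏-doubled-idempotent : ThreePotent A → ∀ Γ → Idempotentᴰ (∏ (doubled Γ))
  ∏-doubled-idempotent T [] = pos≤pos (≤-reflexive (sym (*-identityˡ 𝟙)))
  ∏-doubled-idempotent T (x ∷ Γ) = subst Idempotentᴰ (⊛-assoc x x (∏ (doubled Γ)))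
    (⊛-idempotent (square-idempotent T x) (∏-doubled-idempotent T Γ))

  idempotent-below-⊛ : ∀ {p x y} → Idempotentᴰ p → p ≤ᴰ x → p ≤ᴰ y → p ≤ᴰ x ⊛ y
  idempotent-below-⊛ {p} idem p≤x p≤y =
    ≤ᴰ-trans idem (≤ᴰ-trans (⊛-monoˡ p p≤x) (⊛-monoʳ _ p≤y))

  -- If the squares of x and y lie below γ, so does the square of x ∨ y:
  -- by three-potency it suffices to bound (x ∨ y)³, and each of its eight
  -- terms contains a factor x ⊛ x or y ⊛ y.
  square-∨ᴰ : ThreePotent A → ∀ x y {γ} → x ⊛ x ≤ᴰ γ → y ⊛ y ≤ᴰ γ → (x ∨ᴰ y) ⊛ (x ∨ᴰ y) ≤ᴰ γ
  square-∨ᴰ T x y {γ} x²≤γ y²≤γ =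
    ≤ᴰ-trans (three-potentᴰ T z) (⊛-∨ᴰ-boundˡ x y (z ⊛ z) x⊛zz≤γ y⊛zz≤γ)
    where
    open PreorderReasoning ≤ᴰ-preorder
    z = x ∨ᴰ y

    x²⊛-≤γ : ∀ w → x ⊛ x ⊛ w ≤ᴰ γ
    x²⊛-≤γ w = ≤ᴰ-trans (⊛-decreasingˡ (x ⊛ x) w) x²≤γ

    y²⊛-≤γ : ∀ w → y ⊛ y ⊛ w ≤ᴰ γ
    y²⊛-≤γ w = ≤ᴰ-trans (⊛-decreasingˡ (y ⊛ y) w) y²≤γ

    x⊛y⊛z≤γ : x ⊛ y ⊛ z ≤ᴰ γ
    x⊛y⊛z≤γ = ⊛-∨ᴰ-boundʳ (x ⊛ y) x y
      (≤ᴰ-trans (≤ᴰ-reflexive (⊛-swapʳ x y x)) (x²⊛-≤γ y))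
      (begin x ⊛ y ⊛ y    ≡⟨ ⊛-assoc x y y ⟩
             x ⊛ (y ⊛ y)  ≲⟨ ⊛-decreasingʳ x (y ⊛ y) ⟩
             y ⊛ y        ≲⟨ y²≤γ ⟩
             γ            ∎)

    x⊛zz≤γ : x ⊛ (z ⊛ z) ≤ᴰ γ
    x⊛zz≤γ = ≤ᴰ-trans (≤ᴰ-reflexive (sym (⊛-assoc x z z))) (⊛-∨ᴰ-boundʳ (x ⊛ z) x y
      (≤ᴰ-trans (≤ᴰ-reflexive (⊛-swapʳ x z x)) (x²⊛-≤γ z))
      (≤ᴰ-trans (≤ᴰ-reflexive (⊛-swapʳ x z y)) x⊛y⊛z≤γ))

    y⊛zz≤γ : y ⊛ (z ⊛ z) ≤ᴰ γ
    y⊛zz≤γ = ≤ᴰ-trans (≤ᴰ-reflexive (sym (⊛-assoc y z z))) (⊛-∨ᴰ-boundʳ (y ⊛ z) x y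
      (begin y ⊛ z ⊛ x  ≡⟨ ⊛-swapʳ y z x ⟩
             y ⊛ x ⊛ z  ≡⟨ cong (_⊛ z) (⊛-comm y x) ⟩
             x ⊛ y ⊛ z  ≲⟨ x⊛y⊛z≤γ ⟩
             γ          ∎)
      (≤ᴰ-trans (≤ᴰ-reflexive (⊛-swapʳ y z y)) (y²⊛-≤γ z)))

  ⇒l-sound : ∀ Γ φ ψ γ → (Γ ⇒* φ) ≡ 𝟙ᴰ → ψ ⇒ᴰ γ ≡ 𝟙ᴰ → (Γ ⇒* ((φ ⇒ᴰ ψ) ⇒ᴰ γ)) ≡ 𝟙ᴰ
  ⇒l-sound Γ φ ψ γ p q = valid← Γ _ (residuateᴰ (φ ⇒ᴰ ψ) (∏ Γ) γ (begin
    (φ ⇒ᴰ ψ) ⊛ ∏ Γ  ≲⟨ ⊛-monoʳ (φ ⇒ᴰ ψ) (valid→ Γ φ p) ⟩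
    (φ ⇒ᴰ ψ) ⊛ φ    ≡⟨ ⊛-comm (φ ⇒ᴰ ψ) φ ⟩
    φ ⊛ (φ ⇒ᴰ ψ)    ≲⟨ modus-ponensᴰ φ ψ ⟩
    ψ               ≲⟨ ⇒ᴰ≡𝟙→≤ᴰ ψ γ q ⟩
    γ               ∎))
    where open PreorderReasoning ≤ᴰ-preorder

  C-sound : ThreePotent A → ∀ φ γ → φ ⇒ᴰ φ ⇒ᴰ φ ⇒ᴰ γ ≡ 𝟙ᴰ → φ ⇒ᴰ φ ⇒ᴰ γ ≡ 𝟙ᴰ
  C-sound T φ γ p = square-valid← φ γ (≤ᴰ-trans (three-potentᴰ T φ) (⇒ᴰ≡𝟙→≤ᴰ _ γ cube⇒γ))
    where
    open ≡-Reasoning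
    cube⇒γ : φ ⊛ (φ ⊛ φ) ⇒ᴰ γ ≡ 𝟙ᴰ
    cube⇒γ = begin
      φ ⊛ (φ ⊛ φ) ⇒ᴰ γ    ≡⟨ curryᴰ φ (φ ⊛ φ) γ ⟨
      φ ⇒ᴰ φ ⊛ φ ⇒ᴰ γ     ≡⟨ cong (φ ⇒ᴰ_) (curryᴰ φ φ γ) ⟨
      φ ⇒ᴰ φ ⇒ᴰ φ ⇒ᴰ γ    ≡⟨ p ⟩
      𝟙ᴰ                  ∎

  ∨l2-sound : ThreePotent A → ∀ φ ψ γ → φ ⇒ᴰ φ ⇒ᴰ γ ≡ 𝟙ᴰ → ψ ⇒ᴰ ψ ⇒ᴰ γ ≡ 𝟙ᴰ
            → (φ ∨ᴰ ψ) ⇒ᴰ (φ ∨ᴰ ψ) ⇒ᴰ γ ≡ 𝟙ᴰ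
  ∨l2-sound T φ ψ γ p q = square-valid← (φ ∨ᴰ ψ) γ
    (square-∨ᴰ T φ ψ (square-valid→ φ γ p) (square-valid→ ψ γ q))

  -- (¬⇒r): the doubled context is idempotent, and ¬(φ ⇒ ψ) = φ ⊛ ¬ψ.
  ¬⇒r-sound : ThreePotent A → ∀ Γ φ ψ → (Γ ⇒²* (φ ∧ᴰ ∼ ψ)) ≡ 𝟙ᴰ → (Γ ⇒²* ∼ (φ ⇒ᴰ ψ)) ≡ 𝟙ᴰ
  ¬⇒r-sound T Γ φ ψ p = valid²← Γ _ (≤ᴰ-trans
    (idempotent-below-⊛ (∏-doubled-idempotent T Γ)
      (≤ᴰ-trans Γ≤φ∧¬ψ (x∧ᴰy≤x φ (∼ ψ))) (≤ᴰ-trans Γ≤φ∧¬ψ (x∧ᴰy≤y φ (∼ ψ))))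
    (≤ᴰ-reflexive (sym (∼-⇒ᴰ φ ψ))))
    where
    Γ≤φ∧¬ψ : ∏ (doubled Γ) ≤ᴰ φ ∧ᴰ ∼ ψ
    Γ≤φ∧¬ψ = valid²→ Γ _ p

  sufficiency : ThreePotent A → IsSAlgebra (Double A)
  sufficiency T = record
    { A1 = ⇒ᴰ-refl
    ; A2 = λ y → ≤ᴰ→⇒ᴰ≡𝟙 (≤ᴰ-bottom y)
    ; A3 = λ x → trans (curryᴰ (∼ x) x 𝟘ᴰ) (≤ᴰ→⇒ᴰ≡𝟙 (∼x⊛x≤𝟘ᴰ x))
    ; A4 = refl
    ; A5 = λ x y → ⇔ᴰ-refl (sym (contraposition x y))
    ; refl⇒ = ⇒ᴰ-refl
    ; P = λ Γ φ ψ γ → subst (λ u → (Γ ⇒* u) ≡ 𝟙ᴰ) (exchangeᴰ φ ψ γ)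
    ; C = C-sound T
    ; E = λ Γ φ γ p q → valid← Γ γ (≤ᴰ-trans (valid→ Γ φ p) (⇒ᴰ≡𝟙→≤ᴰ φ γ q))
    ; ⇒l = ⇒l-sound
    ; ⇒r = λ { φ γ refl → ≤ᴰ→⇒ᴰ≡𝟙 (≤ᴰ-top φ) }
    ; ∧l1 = λ φ ψ γ p → ≤ᴰ→⇒ᴰ≡𝟙 (≤ᴰ-trans (x∧ᴰy≤x φ ψ) (⇒ᴰ≡𝟙→≤ᴰ φ γ p))
    ; ∧l2 = λ φ ψ γ p → ≤ᴰ→⇒ᴰ≡𝟙 (≤ᴰ-trans (x∧ᴰy≤y φ ψ) (⇒ᴰ≡𝟙→≤ᴰ ψ γ p))
    ; ∧r = λ Γ φ ψ p q → valid← Γ _ (∧ᴰ-greatest (valid→ Γ φ p) (valid→ Γ ψ q))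
    ; ∨l1 = λ φ ψ γ p q → ≤ᴰ→⇒ᴰ≡𝟙 (∨ᴰ-least (⇒ᴰ≡𝟙→≤ᴰ φ γ p) (⇒ᴰ≡𝟙→≤ᴰ ψ γ q))
    ; ∨l2 = ∨l2-sound T
    ; ∨r1 = λ Γ φ ψ p → valid← Γ _ (≤ᴰ-trans (valid→ Γ φ p) (x≤x∨ᴰy φ ψ))
    ; ∨r2 = λ Γ φ ψ p → valid← Γ _ (≤ᴰ-trans (valid→ Γ ψ p) (y≤x∨ᴰy φ ψ))
    ; ¬⇒l = λ φ ψ γ p → ≤ᴰ→⇒ᴰ≡𝟙
              (≤ᴰ-trans (≤ᴰ-reflexive (∼-⇒ᴰ φ ψ)) (≤ᴰ-trans (⊛≤∧ᴰ φ (∼ ψ)) (⇒ᴰ≡𝟙→≤ᴰ _ γ p)))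
    ; ¬⇒r = ¬⇒r-sound T
    ; ¬∧l = λ φ ψ γ → subst (λ u → u ⇒ᴰ γ ≡ 𝟙ᴰ) (sym (∼-∧ᴰ φ ψ))
    ; ¬∧r = λ Γ φ ψ → subst (λ u → (Γ ⇒* u) ≡ 𝟙ᴰ) (sym (∼-∧ᴰ φ ψ))
    ; ¬∨l = λ φ ψ γ → subst (λ u → u ⇒ᴰ γ ≡ 𝟙ᴰ) (sym (∼-∨ᴰ φ ψ))
    ; ¬∨r = λ Γ φ ψ → subst (λ u → (Γ ⇒* u) ≡ 𝟙ᴰ) (sym (∼-∨ᴰ φ ψ))
    ; ¬¬l = λ φ γ → subst (λ u → u ⇒ᴰ γ ≡ 𝟙ᴰ) (sym (∼-involutive φ))
    ; ¬¬r = λ Γ φ → subst (λ u → (Γ ⇒* u) ≡ 𝟙ᴰ) (sym (∼-involutive φ))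
    ; antisym = λ x y p q → ≤ᴰ-antisym (⇒ᴰ≡𝟙→≤ᴰ x y p) (⇒ᴰ≡𝟙→≤ᴰ y x q)
    }

  -- Necessity: rule (C) with φ = x ∈ A and γ = x³ turns the trivial
  -- x ⇒ (x ⇒ (x ⇒ x³)) = 1 into x ⇒ (x ⇒ x³) = 1, i.e. x² ≤ x³.
  necessity : IsSAlgebra (Double A) → ThreePotent A
  necessity S x = ⇒≡𝟙→≤ (begin
    (x * x) ⇒ x³     ≡⟨ curry x x x³ ⟨
    x ⇒ (x ⇒ x³)     ≡⟨ inj₁-injective (IsSAlgebra.C S (inj₁ x) (inj₁ x³) (cong inj₁ cube-premise)) ⟩
    𝟙                ∎)
    where
    open ≡-Reasoning
    x³ : Carrier
    x³ = (x * x) * x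

    cube-premise : x ⇒ (x ⇒ (x ⇒ x³)) ≡ 𝟙
    cube-premise = begin
      x ⇒ (x ⇒ (x ⇒ x³))  ≡⟨ curry x x (x ⇒ x³) ⟩
      (x * x) ⇒ (x ⇒ x³)  ≡⟨ curry (x * x) x x³ ⟩
      x³ ⇒ x³             ≡⟨ ≤→⇒≡𝟙 ≤-refl ⟩
      𝟙                   ∎

proposition5p3 : ∀ {a : Level} (A : CIRL a) → IsSAlgebra (Double A) ⇔ ThreePotent A
proposition5p3 A = mk⇔ necessity sufficiency
  where open Doubling A
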